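{- Let $\mathcal{G}=(V,V_i,V_t,P)$ be a production grammar satisfying the standing assumptions below, and let $M_{\mathcal{G}}$ be its generative production machine. A sentence $\sigma$ is producible by $M_{\mathcal{G}}$ if and only if $\sigma$ is in the leftmost language of $\mathcal{G}$.
   Context: Production grammars. A production grammar is $\mathcal{G}=(V,V_i,V_t,P)$ with $V$ a finite alphabet, $V_i,V_t\subseteq V$ (initial and terminal vocabularies) and $P$ a finite set of pairs $(\Gamma,\Delta)$ of strings over $V$, written $\Gamma\to\Delta$. Elements of $V_t$ are terminals, elements of $V\setminus V_t$ nonterminals; a sentence is a string of terminals. A production $\Gamma\to\Delta$ is applicable to a string $\sigma$ if $\sigma=\sigma_1\Gamma\sigma_2$; its application gives $\sigma_1\Delta\sigma_2$. It is leftmost applicable (at the occurrence $\sigma=\sigma_1\Gamma\sigma_2$) if for every production $\Gamma'\to\Delta'$ and every decomposition $\sigma=\gamma_1\Gamma'\gamma_2$ one has $|\Gamma|\le|\Gamma'|$ and $|\sigma_1|\le|\gamma_1|$. Write $\sigma\longrightarrow\sigma'$ (leftmost reduction) if some production is leftmost applicable to $\sigma$ and $\sigma'$ is the result of that application. The leftmost language of $\mathcal{G}$ is the set of sentences reachable from symbols of $V_i$ by finitely many leftmost reductions. Standing assumptions: $\mathcal{G}$ is well-formed (every reduction sequence ultimately leads to a sentence); no production has an empty side; no terminal occurs on the left side of a production; $\mathcal{G}$ is normal (both sides of every production have length 1 or 2); $V_i=\{S\}$; and every production whose right side contains a terminal has as right side a single terminal symbol. Production machine. It has three tapes (top and bottom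 storage tapes, middle input/output tape), infinite in both directions and divided into squares, each square empty or holding one symbol; one square of each tape is scanned, the three scanned squares being aligned. A tape moving "left" shifts one square to the left, so the square formerly immediately to its right becomes scanned; "right" is the opposite; "stay" means no motion. Writing (top, middle, bottom) for the contents of the three scanned squares, $\emptyset$ for empty and $(X)$ for "either empty or $X$", the moves are: (1) $(C,\emptyset,(A))$: $C$ is moved into the middle square, the top square becomes empty. (2) $(\emptyset,B,\emptyset)$: the top tape moves left, the middle square becomes empty, and $B$ is written into the bottom square. (3) $(C,B,(A))$: the top tape moves right; the others stay. (4) $(\emptyset,B,A)$ with $A$ nonempty: the bottom tape moves left; the others stay. (5) $(\emptyset,B,(A))$, provided $(A)B\to C(D)$ is a production in $P$ (its left side is $AB$ if the bottom square holds $A$, and $B$ if it is empty; its right side is $C$ or $CD$): $C$ is written into the middle square, $D$ (if present) into the top square, and the bottom tape moves right, the symbol $A$ (if any) being removed. (6) $(\emptyset,D,\emptyset)$ with $D\in V_t$: the top and middle tapes move left (so $D$ becomes output to the left of the scanned middle square). The generative machine $M_{\mathcal{G}}$ starts in the state where the scanned top square holds $S$ and all other squares are empty; at each step it performs the first applicable move in the order 5, 6, 1, 2, 3, 4, the choice of production in move 5 being nondeterministic. A sentence $\sigma$ is producible by $M_{\mathcal{G}}$ if the machine can reach, from the initial state, the state in which the middle tape holds $\sigma$ in the squares immediately to the left of the scanned square and all other squares are empty. -}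

module Defs where

open import Data.Nat using (ℕ; zero; suc; _≤_)
open import Data.Integer using (ℤ; +_; -[1+_]; _+_; _-_; 0ℤ; 1ℤ)
import Data.Integer as ℤ
open import Data.Fin using (Fin)
open import Data.Fin.Subset using (Subset; _∈_; _∉_)
open import Data.List using (List; []; _∷_; _++_; [_]; length; reverse)
open import Data.List.Relation.Unary.All using (All)
open import Data.List.Relation.Unary.Any using (Any)
import Data.List.Membership.Propositional as Mem
open import Data.Maybe using (Maybe; just; nothing)
open import Data.Product using (Σ; ∃; _×_; _,_)
open import Data.Sum using (_⊎_)
open import Relation.Nullary using (¬_; yes; no)
open import Relation.Binary.PropositionalEquality using (_≡_; _≢_)
open import Relation.Binary.Construct.Closure.ReflexiveTransitive using (Star)
open import Induction.WellFounded using (Acc)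

-- Production grammars over the finite alphabet V = Fin n,
-- with V_i = {S}, V_t given as a subset of V, and P a finite list
-- of productions (Γ , Δ) written Γ → Δ.

Str : ℕ → Set
Str n = List (Fin n)

Production : ℕ → Set
Production n = Str n × Str n

record Grammar (n : ℕ) : Set where
  field
    Vt : Subset n
    S  : Fin n
    P  : List (Production n)

module _ {n : ℕ} (G : Grammar n) where
  open Grammar G

  Sentence : Str n → Set
  Sentence σ = All (_∈ Vt) σ

  LeftmostApplicable : Str n → Str n → Str n → Str n → Str n → Set
  LeftmostApplicable σ σ₁ Γ Δ σ₂ =
    (Γ , Δ) Mem.∈ P × σ ≡ σ₁ ++ Γ ++ σ₂ ×
    (∀ Γ' Δ' → (Γ' , Δ') Mem.∈ P → ∀ γ₁ γ₂ → σ ≡ γ₁ ++ Γ' ++ γ₂ →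
       length Γ ≤ length Γ' × length σ₁ ≤ length γ₁)

  _⟶_ : Str n → Str n → Set
  σ ⟶ σ' = ∃ λ σ₁ → ∃ λ Γ → ∃ λ Δ → ∃ λ σ₂ →
    LeftmostApplicable σ σ₁ Γ Δ σ₂ × σ' ≡ σ₁ ++ Δ ++ σ₂

  InLeftmostLanguage : Str n → Set
  InLeftmostLanguage σ = Sentence σ × Star _⟶_ [ S ] σ

  -- well-formed: every (leftmost) reduction sequence starting from the
  -- initial symbol ultimately leads to a sentence, i.e. every such sequence
  -- is finite (no infinite chain of reductions from a reachable string) and
  -- every reachable string to which no reduction applies is a sentence.
  WellFormed : Set
  WellFormed = ∀ σ → Star _⟶_ [ S ] σ →
    Acc (λ τ τ' → τ' ⟶ τ) σ × ((∀ σ' → ¬ (σ ⟶ σ')) → Sentence σ)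

  NoEmptySide : Set
  NoEmptySide = ∀ Γ Δ → (Γ , Δ) Mem.∈ P → Γ ≢ [] × Δ ≢ []

  NoTerminalOnLeft : Set
  NoTerminalOnLeft = ∀ Γ Δ → (Γ , Δ) Mem.∈ P → All (_∉ Vt) Γ

  LenOneOrTwo : Str n → Set
  LenOneOrTwo xs = length xs ≡ 1 ⊎ length xs ≡ 2

  Normal : Set
  Normal = ∀ Γ Δ → (Γ , Δ) Mem.∈ P → LenOneOrTwo Γ × LenOneOrTwo Δ

  TerminalRulesSingle : Set
  TerminalRulesSingle = ∀ Γ Δ → (Γ , Δ) Mem.∈ P → Any (_∈ Vt) Δ →
    ∃ λ t → Δ ≡ [ t ]

  record StandingAssumptions : Set where
    field
      wellFormed       : WellFormed
      noEmptySide      : NoEmptySide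
      noTerminalOnLeft : NoTerminalOnLeft
      normal           : Normal
      terminalRules    : TerminalRulesSingle

-- Tapes: infinite in both directions; square 0 is the scanned square,
-- nothing = empty square.

Tape : ℕ → Set
Tape n = ℤ → Maybe (Fin n)

-- tape moves left: the square formerly immediately to the right is scanned
moveL : ∀ {n} → Tape n → Tape n
moveL t i = t (i + 1ℤ)

-- tape moves right: the square formerly immediately to the left is scanned
moveR : ∀ {n} → Tape n → Tape n
moveR t i = t (i - 1ℤ)

write : ∀ {n} → Maybe (Fin n) → Tape n → Tape n
write x t i with i ℤ.≟ 0ℤ
... | yes _ = x
... | no  _ = t i

emptyTape : ∀ {n} → Tape n
emptyTape _ = nothing

record MState (n : ℕ) : Set where
  constructor ⟨_,_,_⟩
  field
    top mid bot : Tape n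
open MState public

-- left side (A)B of a move-5 production, given the bottom square
ctxLhs : ∀ {n} → Maybe (Fin n) → Fin n → Str n
ctxLhs nothing  B = [ B ]
ctxLhs (just A) B = A ∷ B ∷ []

rhsTop : ∀ {n} → Str n → Maybe (Fin n)
rhsTop (C ∷ D ∷ []) = just D
rhsTop _            = nothing

module Machine {n : ℕ} (G : Grammar n) where
  open Grammar G

  App5 App6 App1 App2 App3 App4 : MState n → Set
  App5 s = top s 0ℤ ≡ nothing × ∃ λ B → mid s 0ℤ ≡ just B ×
           ∃ λ Δ → (ctxLhs (bot s 0ℤ) B , Δ) Mem.∈ P
  App6 s = top s 0ℤ ≡ nothing × bot s 0ℤ ≡ nothing ×
           ∃ λ D → mid s 0ℤ ≡ just D × D ∈ Vt
  App1 s = (∃ λ C → top s 0ℤ ≡ just C) × mid s 0ℤ ≡ nothing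
  App2 s = top s 0ℤ ≡ nothing × (∃ λ B → mid s 0ℤ ≡ just B) × bot s 0ℤ ≡ nothing
  App3 s = (∃ λ C → top s 0ℤ ≡ just C) × (∃ λ B → mid s 0ℤ ≡ just B)
  App4 s = top s 0ℤ ≡ nothing × (∃ λ B → mid s 0ℤ ≡ just B) ×
           (∃ λ A → bot s 0ℤ ≡ just A)

  -- one step: the first applicable move in the order 5, 6, 1, 2, 3, 4
  -- (move 5 choosing nondeterministically among the matching productions)
  data Step : MState n → MState n → Set where
    move5 : ∀ {s} B C Δ →
      top s 0ℤ ≡ nothing → mid s 0ℤ ≡ just B →
      (ctxLhs (bot s 0ℤ) B , Δ) Mem.∈ P →
      (Δ ≡ [ C ] ⊎ ∃ λ D → Δ ≡ C ∷ D ∷ []) →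
      Step s ⟨ write (rhsTop Δ) (top s) , write (just C) (mid s) ,
               moveR (write nothing (bot s)) ⟩
    move6 : ∀ {s} → ¬ App5 s → App6 s →
      Step s ⟨ moveL (top s) , moveL (mid s) , bot s ⟩
    move1 : ∀ {s} C → ¬ App5 s → ¬ App6 s →
      top s 0ℤ ≡ just C → mid s 0ℤ ≡ nothing →
      Step s ⟨ write nothing (top s) , write (just C) (mid s) , bot s ⟩
    move2 : ∀ {s} B → ¬ App5 s → ¬ App6 s → ¬ App1 s →
      top s 0ℤ ≡ nothing → mid s 0ℤ ≡ just B → bot s 0ℤ ≡ nothing →
      Step s ⟨ moveL (top s) , write nothing (mid s) , write (just B) (bot s) ⟩
    move3 : ∀ {s} → ¬ App5 s → ¬ App6 s → ¬ App1 s → ¬ App2 s → App3 s →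
      Step s ⟨ moveR (top s) , mid s , bot s ⟩
    move4 : ∀ {s} → ¬ App5 s → ¬ App6 s → ¬ App1 s → ¬ App2 s → ¬ App3 s →
      App4 s →
      Step s ⟨ top s , mid s , moveL (bot s) ⟩

  initial : MState n
  initial = ⟨ write (just S) emptyTape , emptyTape , emptyTape ⟩

nth : ∀ {A : Set} → List A → ℕ → Maybe A
nth []       _       = nothing
nth (x ∷ xs) zero    = just x
nth (x ∷ xs) (suc k) = nth xs k

outputTape : ∀ {n} → Str n → Tape n
outputTape σ (+ _)      = nothing
outputTape σ -[1+ k ]   = nth (reverse σ) k

module _ {n : ℕ} (G : Grammar n) where
  open Machine G

  Final : Str n → MState n → Set
  Final σ s = ∀ i → top s i ≡ nothing × mid s i ≡ outputTape σ i × bot s i ≡ nothing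

  Producible : Str n → Set
  Producible σ = ∃ λ s → Star Step initial s × Final σ s

{-# OPTIONS --safe #-}
-- The machine performs leftmost reduction on a sentential form spread over its tapes: the part
-- left of the middle square (the output so far, followed by the stack on the bottom tape)
-- contains no left side, the middle square holds the symbol being examined, and the top tape
-- holds the unread rest.  Moves 1-4 and 6 only shift symbols between the tapes; move 5 rewrites
-- the middle symbol, or the scanned stack top together with it, and that occurrence is exactly
-- the leftmost-applicable one.  For a single-symbol left side this holds because nothing to its
-- left is reducible; for a two-symbol one it needs well-formedness: if a single-symbol left side
-- occurred further right, no production would be leftmost applicable, although the form is not
-- a sentence.  Well-formedness also shows that the machine never emits a terminal while
-- nonterminals remain on the stack, since they could then never be rewritten.  Hence a run
-- ending in the final state yields a leftmost derivation of its output; conversely, since the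
-- leftmost-applicable occurrence is unique, the machine can follow any leftmost derivation,
-- choosing in move 5 the production that the derivation applies.
module Submission where

open import Defs
open import Data.Empty using (⊥; ⊥-elim)
open import Data.Fin using (Fin; _≟_)
open import Data.Fin.Subset using (_∈_; _∉_)
open import Data.Fin.Subset.Properties using (_∈?_)
open import Data.Integer using (+_; -[1+_]; 0ℤ)
open import Data.List using (List; []; _∷_; _++_; [_]; _∷ʳ_; length; reverse; head; drop; fromMaybe)
open import Data.List.Properties
  using (≡-dec; ∷-injective; ∷ʳ-injective; ∷ʳ-++; ++-assoc; ++-identityʳ; length-++-≤ˡ;
         unfold-reverse; ʳ++-defn; reverse-involutive)
open import Data.List.Relation.Binary.Permutation.Propositional using (↭-sym)
open import Data.List.Relation.Binary.Permutation.Propositional.Properties using (All-resp-↭; ↭-reverse)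
import Data.List.Membership.Propositional as Mem
open import Data.List.Relation.Unary.All using (All; []; _∷_)
open import Data.List.Relation.Unary.All.Properties using (++⁻ˡ; ++⁻ʳ)
open import Data.List.Relation.Unary.Any using (Any; any?)
open import Data.Maybe using (Maybe; just; nothing)
open import Data.Nat using (ℕ; zero; suc; _≤_; _<_; z≤n; s≤s)
open import Data.Nat.Properties
  using (+-comm; +-identityʳ; ≤-antisym; ≤-reflexive; <⇒≤; <⇒≱; suc-injective)
open import Data.Product using (∃; ∃₂; _×_; _,_; proj₁; proj₂)
open import Data.Sum using (_⊎_; inj₁; inj₂)
open import Function.Base using (_∘_)
open import Function.Bundles using (_⇔_; mk⇔; module Equivalence)
open import Induction.WellFounded using (Acc; acc)
open import Relation.Binary.Construct.Closure.ReflexiveTransitive using (Star; ε; _◅_; _◅◅_)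
open import Relation.Binary.PropositionalEquality using (_≡_; _≢_; refl; sym; trans; cong; subst; _≗_)
open import Relation.Nullary using (¬_; Dec; yes; no)
open import Relation.Nullary.Decidable using (map′)

module _ {A : Set} where

  just≢nothing : ∀ {x : A} → just x ≢ nothing
  just≢nothing ()

  ++-split : (a b c d : List A) → a ++ b ≡ c ++ d →
    (∃ λ τ → c ≡ a ++ τ × b ≡ τ ++ d) ⊎ (∃ λ τ → a ≡ c ++ τ × d ≡ τ ++ b)
  ++-split []      b c       d eq = inj₁ (c , refl , eq)
  ++-split (x ∷ a) b []      d eq = inj₂ (x ∷ a , refl , sym eq)
  ++-split (x ∷ a) b (y ∷ c) d eq with ∷-injective eq
  ... | refl , eq′ with ++-split a b c d eq′
  ...   | inj₁ (τ , refl , e) = inj₁ (τ , refl , e)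
  ...   | inj₂ (τ , refl , e) = inj₂ (τ , refl , e)

  equal-length-++-injective : (a b c d : List A) → a ++ b ≡ c ++ d → length a ≡ length c →
    a ≡ c × b ≡ d
  equal-length-++-injective []      b []      d eq _ = refl , eq
  equal-length-++-injective (x ∷ a) b (y ∷ c) d eq l with ∷-injective eq
  ... | refl , eq′ with equal-length-++-injective a b c d eq′ (suc-injective l)
  ...   | refl , e = refl , e

  ∷ʳ-++-longer : ∀ (xs : List A) x ys → length xs < length ((xs ∷ʳ x) ++ ys)
  ∷ʳ-++-longer []       x ys = s≤s z≤n
  ∷ʳ-++-longer (_ ∷ xs) x ys = s≤s (∷ʳ-++-longer xs x ys)

  reverse-∷-++ : ∀ (x : A) xs ys → reverse (x ∷ xs) ++ ys ≡ reverse xs ++ x ∷ ys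
  reverse-∷-++ x xs ys = trans (sym (ʳ++-defn (x ∷ xs))) (ʳ++-defn xs)

  all-reverse : ∀ {P : A → Set} {xs} → All P xs → All P (reverse xs)
  all-reverse = All-resp-↭ (↭-sym (↭-reverse _))

  all-reverse-∷⁻ : ∀ {P : A → Set} {x xs} → All P (reverse (x ∷ xs)) → P x
  all-reverse-∷⁻ {x = x} {xs} p with ++⁻ʳ (reverse xs) (subst (All _) (unfold-reverse x xs) p)
  ... | px ∷ _ = px

  head≡nothing : (xs : List A) → head xs ≡ nothing → xs ≡ []
  head≡nothing [] _ = refl

  head-drop : (xs : List A) → fromMaybe (head xs) ++ drop 1 xs ≡ xs
  head-drop []      = refl
  head-drop (_ ∷ _) = refl

  head-drop-++ : (xs ys : List A) → fromMaybe (head xs) ++ drop 1 xs ++ ys ≡ xs ++ ys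
  head-drop-++ []      _ = refl
  head-drop-++ (_ ∷ _) _ = refl

  reverse-shift : ∀ (x : A) xs ys →
    reverse xs ++ x ∷ ys ≡ reverse (x ∷ xs) ++ fromMaybe (head ys) ++ drop 1 ys
  reverse-shift x xs ys =
    trans (cong (λ zs → reverse xs ++ x ∷ zs) (sym (head-drop ys))) (sym (reverse-∷-++ x xs _))

  nth-injective : (xs ys : List A) → (∀ k → nth xs k ≡ nth ys k) → xs ≡ ys
  nth-injective []       []       _ = refl
  nth-injective []       (y ∷ ys) e with e 0
  ... | ()
  nth-injective (x ∷ xs) []       e with e 0
  ... | ()
  nth-injective (x ∷ xs) (y ∷ ys) e with e 0
  ... | refl = cong (x ∷_) (nth-injective xs ys (e ∘ suc))

module _ {n : ℕ} where

  tape : Str n → Maybe (Fin n) → Str n → Tape n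
  tape ls m rs (+ zero)  = m
  tape ls m rs (+ suc k) = nth rs k
  tape ls m rs -[1+ k ]  = nth ls k

  private
    nth-zero : ∀ (xs : Str n) → nth xs 0 ≡ head xs
    nth-zero []      = refl
    nth-zero (_ ∷ _) = refl

    nth-suc : ∀ (xs : Str n) k → nth xs (suc k) ≡ nth (drop 1 xs) k
    nth-suc []      k = refl
    nth-suc (_ ∷ _) k = refl

    moveL-positive : ∀ (t : Tape n) k → moveL t (+ k) ≡ t (+ suc k)
    moveL-positive t k = cong (t ∘ +_) (+-comm k 1)

    moveR-negative : ∀ (t : Tape n) k → moveR t -[1+ k ] ≡ t -[1+ suc k ]
    moveR-negative t k = cong (λ j → t -[1+ suc j ]) (+-identityʳ k)

  tape-injective : ∀ {ls m rs ls′ m′ rs′} → tape ls m rs ≗ tape ls′ m′ rs′ →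
    ls ≡ ls′ × m ≡ m′ × rs ≡ rs′
  tape-injective {ls} {m} {rs} {ls′} {m′} {rs′} e =
    nth-injective ls ls′ (e ∘ -[1+_]) , e (+ zero) , nth-injective rs rs′ (e ∘ +_ ∘ suc)

  emptyTape≗tape : emptyTape ≗ tape [] nothing []
  emptyTape≗tape (+ zero)  = refl
  emptyTape≗tape (+ suc _) = refl
  emptyTape≗tape -[1+ _ ]  = refl

  outputTape≗tape : ∀ σ → outputTape σ ≗ tape (reverse σ) nothing []
  outputTape≗tape σ (+ zero)  = refl
  outputTape≗tape σ (+ suc _) = refl
  outputTape≗tape σ -[1+ _ ]  = refl

  module _ {t : Tape n} where

    write-tape : ∀ {ls m rs} x → t ≗ tape ls m rs → write x t ≗ tape ls x rs
    write-tape x e (+ zero)  = refl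
    write-tape x e (+ suc k) = e (+ suc k)
    write-tape x e -[1+ k ]  = e -[1+ k ]

    moveL-just : ∀ {ls x rs} → t ≗ tape ls (just x) rs → moveL t ≗ tape (x ∷ ls) (head rs) (drop 1 rs)
    moveL-just {rs = rs} e (+ zero)  = trans (e (+ 1)) (nth-zero rs)
    moveL-just {rs = rs} e (+ suc k) = trans (moveL-positive t (suc k)) (trans (e (+ suc (suc k))) (nth-suc rs k))
    moveL-just e -[1+ zero ]  = e (+ zero)
    moveL-just e -[1+ suc k ] = e -[1+ k ]

    moveL-blank : ∀ {rs} → t ≗ tape [] nothing rs → moveL t ≗ tape [] (head rs) (drop 1 rs)
    moveL-blank {rs} e (+ zero)  = trans (e (+ 1)) (nth-zero rs)
    moveL-blank {rs} e (+ suc k) = trans (moveL-positive t (suc k)) (trans (e (+ suc (suc k))) (nth-suc rs k))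
    moveL-blank e -[1+ zero ]  = e (+ zero)
    moveL-blank e -[1+ suc k ] = e -[1+ k ]

    moveR-just : ∀ {ls x rs} → t ≗ tape ls (just x) rs → moveR t ≗ tape (drop 1 ls) (head ls) (x ∷ rs)
    moveR-just {ls} e (+ zero)   = trans (e -[1+ 0 ]) (nth-zero ls)
    moveR-just e (+ suc zero)    = e (+ zero)
    moveR-just e (+ suc (suc k)) = e (+ suc k)
    moveR-just {ls} e -[1+ k ]   = trans (moveR-negative t k) (trans (e -[1+ suc k ]) (nth-suc ls k))

    moveR-blank : ∀ {ls} → t ≗ tape ls nothing [] → moveR t ≗ tape (drop 1 ls) (head ls) []
    moveR-blank {ls} e (+ zero)   = trans (e -[1+ 0 ]) (nth-zero ls)
    moveR-blank e (+ suc zero)    = e (+ zero)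
    moveR-blank e (+ suc (suc k)) = e (+ suc k)
    moveR-blank {ls} e -[1+ k ]   = trans (moveR-negative t k) (trans (e -[1+ suc k ]) (nth-suc ls k))

module Sentential {n : ℕ} (G : Grammar n) where

  open Grammar G

  _⇒_ : Str n → Str n → Set
  _⇒_ = _⟶_ G

  Reachable : Str n → Set
  Reachable = Star _⇒_ [ S ]

  IsLhs : Str n → Set
  IsLhs Γ = ∃ λ Δ → (Γ , Δ) Mem.∈ P

  LhsFree : Str n → Set
  LhsFree σ = ∀ γ₁ Γ γ₂ → σ ≡ γ₁ ++ Γ ++ γ₂ → ¬ IsLhs Γ

  SeamFree : Str n → Fin n → Set
  SeamFree σ X = ∀ γ a → σ ≡ γ ∷ʳ a → ¬ IsLhs (a ∷ X ∷ [])

  Frozen : Str n → Set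
  Frozen σ = LhsFree σ × (∀ X → SeamFree σ X)

  isLhs? : ∀ Γ → Dec (IsLhs Γ)
  isLhs? Γ = map′ witness (λ (_ , m) → Mem.lose m refl) (any? (λ p → ≡-dec _≟_ (proj₁ p) Γ) P)
    where
    witness : Any (λ p → proj₁ p ≡ Γ) P → IsLhs Γ
    witness lhs with Mem.find lhs
    ... | (_ , Δ) , m , refl = Δ , m

  lhsFree-++ˡ : ∀ σ τ → LhsFree (σ ++ τ) → LhsFree σ
  lhsFree-++ˡ σ τ free γ₁ Γ γ₂ refl =
    free γ₁ Γ (γ₂ ++ τ) (trans (++-assoc γ₁ (Γ ++ γ₂) τ) (cong (γ₁ ++_) (++-assoc Γ γ₂ τ)))

  seamFree-∷ʳ : ∀ {σ a X} → ¬ IsLhs (a ∷ X ∷ []) → SeamFree (σ ∷ʳ a) X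
  seamFree-∷ʳ {σ} ¬lhs γ a e with ∷ʳ-injective σ γ e
  ... | _ , refl = ¬lhs

  leftmost-unique : ∀ {σ σ₁ Γ Δ σ₂ τ₁ Γ′ Δ′ τ₂} →
    LeftmostApplicable G σ σ₁ Γ Δ σ₂ → LeftmostApplicable G σ τ₁ Γ′ Δ′ τ₂ →
    σ₁ ≡ τ₁ × Γ ≡ Γ′ × σ₂ ≡ τ₂
  leftmost-unique {σ₁ = σ₁} {Γ} {Δ} {σ₂} {τ₁} {Γ′} {Δ′} {τ₂} (m , e , least) (m′ , e′ , least′)
    with least Γ′ Δ′ m′ τ₁ τ₂ e′ | least′ Γ Δ m σ₁ σ₂ e
  ... | Γ≤Γ′ , σ₁≤τ₁ | Γ′≤Γ , τ₁≤σ₁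
    with equal-length-++-injective σ₁ (Γ ++ σ₂) τ₁ (Γ′ ++ τ₂) (trans (sym e) e′)
                                   (≤-antisym σ₁≤τ₁ τ₁≤σ₁)
  ...   | refl , e″ with equal-length-++-injective Γ σ₂ Γ′ τ₂ e″ (≤-antisym Γ≤Γ′ Γ′≤Γ)
  ...     | refl , refl = refl , refl , refl

module Leftmost {n : ℕ} (G : Grammar n) (SA : StandingAssumptions G) where

  open Grammar G
  open StandingAssumptions SA
  open Sentential G

  data OneOrTwo : Str n → Set where
    one : ∀ x → OneOrTwo [ x ]
    two : ∀ x y → OneOrTwo (x ∷ y ∷ [])

  oneOrTwo : ∀ xs → LenOneOrTwo G xs → OneOrTwo xs
  oneOrTwo (x ∷ [])        _ = one x
  oneOrTwo (x ∷ y ∷ [])    _ = two x y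
  oneOrTwo []              (inj₁ ())
  oneOrTwo []              (inj₂ ())
  oneOrTwo (_ ∷ _ ∷ _ ∷ _) (inj₁ ())
  oneOrTwo (_ ∷ _ ∷ _ ∷ _) (inj₂ ())

  lhs-oneOrTwo : ∀ {Γ Δ} → (Γ , Δ) Mem.∈ P → OneOrTwo Γ
  lhs-oneOrTwo {Γ} {Δ} m = oneOrTwo Γ (proj₁ (normal Γ Δ m))

  rhs-shape : ∀ {Γ Δ} → (Γ , Δ) Mem.∈ P → ∃ λ C → Δ ≡ [ C ] ⊎ ∃ λ D → Δ ≡ C ∷ D ∷ []
  rhs-shape {Γ} {Δ} m with oneOrTwo Δ (proj₂ (normal Γ Δ m))
  ... | one C   = C , inj₁ refl
  ... | two C D = C , inj₂ (D , refl)

  lhs-nonempty : ∀ {Γ Δ} → (Γ , Δ) Mem.∈ P → 1 ≤ length Γ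
  lhs-nonempty m with lhs-oneOrTwo m
  ... | one _   = s≤s z≤n
  ... | two _ _ = s≤s z≤n

  lhs-starts-nonterminal : ∀ {x Γ} → IsLhs (x ∷ Γ) → x ∉ Vt
  lhs-starts-nonterminal (Δ , m) with noTerminalOnLeft _ Δ m
  ... | x∉ ∷ _ = x∉

  sentence-lhsFree : ∀ {σ} → Sentence G σ → LhsFree σ
  sentence-lhsFree σ∈ γ₁ Γ γ₂ refl (Δ , m) with lhs-oneOrTwo m | ++⁻ʳ γ₁ σ∈
  ... | one x   | x∈ ∷ _ = lhs-starts-nonterminal (Δ , m) x∈
  ... | two x y | x∈ ∷ _ = lhs-starts-nonterminal (Δ , m) x∈

  terminal-seamFree : ∀ {σ a X} → a ∈ Vt → SeamFree (σ ∷ʳ a) X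
  terminal-seamFree a∈ = seamFree-∷ʳ (λ lhs → lhs-starts-nonterminal lhs a∈)

  sentence-seamFree : ∀ {σ X} → Sentence G σ → SeamFree σ X
  sentence-seamFree σ∈ γ a refl lhs with ++⁻ʳ γ σ∈
  ... | a∈ ∷ _ = lhs-starts-nonterminal lhs a∈

  occurrence-split : ∀ {Q} R γ₁ γ₂ {Γ Δ} → LhsFree Q → Q ++ R ≡ γ₁ ++ Γ ++ γ₂ → (Γ , Δ) Mem.∈ P →
    (∃ λ τ → γ₁ ≡ Q ++ τ × R ≡ τ ++ Γ ++ γ₂) ⊎
    (∃₂ λ a b → Q ≡ γ₁ ∷ʳ a × Γ ≡ a ∷ b ∷ [] × R ≡ b ∷ γ₂)
  occurrence-split {Q} R γ₁ γ₂ {Γ} {Δ} free e m with ++-split Q R γ₁ (Γ ++ γ₂) e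
  ... | inj₁ inR = inj₁ inR
  ... | inj₂ ([] , refl , e′) =
    inj₁ ([] , sym (trans (++-identityʳ (γ₁ ++ [])) (++-identityʳ γ₁)) , sym e′)
  ... | inj₂ (_ ∷ τ , refl , e′) with lhs-oneOrTwo m | τ | e′
  ...   | one x   | τ′     | refl = ⊥-elim (free γ₁ [ x ] τ′ refl (Δ , m))
  ...   | two x y | []     | refl = inj₂ (x , y , refl , refl , refl)
  ...   | two x y | _ ∷ τ′ | refl = ⊥-elim (free γ₁ (x ∷ y ∷ []) τ′ refl (Δ , m))

  lhsFree-∷ʳ : ∀ {σ X} → LhsFree σ → ¬ IsLhs [ X ] → SeamFree σ X → LhsFree (σ ∷ʳ X)
  lhsFree-∷ʳ {σ} {X} free ¬lhs seam γ₁ Γ γ₂ e (Δ , m)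
    with occurrence-split [ X ] γ₁ γ₂ free e m | lhs-oneOrTwo m
  ... | inj₂ (a , b , eσ , refl , refl) | _     = seam γ₁ a eσ (Δ , m)
  ... | inj₁ ([] , _ , refl)            | one x = ¬lhs (Δ , m)
  ... | inj₁ ([] , _ , ())              | two x y
  ... | inj₁ (_ ∷ [] , _ , ())          | one x
  ... | inj₁ (_ ∷ [] , _ , ())          | two x y
  ... | inj₁ (_ ∷ _ ∷ _ , _ , ())       | _

  frozen-step : ∀ {Q R w} → Frozen Q → (Q ++ R) ⇒ w → ∃ λ R′ → w ≡ Q ++ R′
  frozen-step {Q} {R} (free , seam) (σ₁ , Γ , Δ , σ₂ , (m , e , _) , refl)
    with occurrence-split R σ₁ σ₂ free e m
  ... | inj₁ (τ , refl , _)          = τ ++ Δ ++ σ₂ , ++-assoc Q τ (Δ ++ σ₂)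
  ... | inj₂ (a , b , eQ , refl , _) = ⊥-elim (seam b σ₁ a eQ (Δ , m))

  -- Reductions never touch a frozen prefix, and by well-formedness they end in a sentence.
  frozen-unreachable : ∀ {Q} → Frozen Q → ¬ Sentence G Q → ∀ R → ¬ Reachable (Q ++ R)
  frozen-unreachable {Q} frozen ¬sentence R r = go (proj₁ (wellFormed _ r)) refl r
    where
    go : ∀ {w R} → Acc (λ τ τ′ → τ′ ⇒ τ) w → w ≡ Q ++ R → Reachable w → ⊥
    go {w} (acc more) refl r = ¬sentence (++⁻ˡ Q (proj₂ (wellFormed w r) irreducible))
      where
      irreducible : ∀ w′ → ¬ (w ⇒ w′)
      irreducible w′ step = go (more step) (proj₂ (frozen-step frozen step)) (r ◅◅ step ◅ ε)

  leftmost-single : ∀ {L X r Δ} → LhsFree L → SeamFree L X → ([ X ] , Δ) Mem.∈ P →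
    LeftmostApplicable G (L ++ X ∷ r) L [ X ] Δ r
  leftmost-single {L} {X} {r} free seam m = m , refl , least
    where
    least : ∀ Γ′ Δ′ → (Γ′ , Δ′) Mem.∈ P → ∀ γ₁ γ₂ → L ++ X ∷ r ≡ γ₁ ++ Γ′ ++ γ₂ →
            1 ≤ length Γ′ × length L ≤ length γ₁
    least Γ′ Δ′ m′ γ₁ γ₂ e with occurrence-split (X ∷ r) γ₁ γ₂ free e m′
    ... | inj₁ (τ , refl , _)             = lhs-nonempty m′ , length-++-≤ˡ L
    ... | inj₂ (a , b , eL , refl , refl) = ⊥-elim (seam γ₁ a eL (Δ′ , m′))

  leftmost-pair : ∀ {L A X r Δ} → LhsFree (L ∷ʳ A) → Reachable (L ++ A ∷ X ∷ r) →
    (A ∷ X ∷ [] , Δ) Mem.∈ P → LeftmostApplicable G (L ++ A ∷ X ∷ r) L (A ∷ X ∷ []) Δ r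
  leftmost-pair {L} {A} {X} {r} {Δ} free reach m = m , refl , least
    where
    split : ∀ γ₁ γ₂ {Γ′ Δ′} → (Γ′ , Δ′) Mem.∈ P → L ++ A ∷ X ∷ r ≡ γ₁ ++ Γ′ ++ γ₂ →
      (∃ λ τ → γ₁ ≡ (L ∷ʳ A) ++ τ × X ∷ r ≡ τ ++ Γ′ ++ γ₂) ⊎
      (∃₂ λ a b → L ∷ʳ A ≡ γ₁ ∷ʳ a × Γ′ ≡ a ∷ b ∷ [] × X ∷ r ≡ b ∷ γ₂)
    split γ₁ γ₂ m′ e = occurrence-split (X ∷ r) γ₁ γ₂ free (trans (∷ʳ-++ L A (X ∷ r)) e) m′

    -- A leftmost-applicable occurrence would have to be no longer than [ y ] and start no later
    -- than A X; none does, so the form would be irreducible, hence a sentence.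
    no-single : ∀ y γ₁ γ₂ → L ++ A ∷ X ∷ r ≡ γ₁ ++ [ y ] ++ γ₂ → ¬ IsLhs [ y ]
    no-single y γ₁ γ₂ e (Δ′ , m′) =
      lhs-starts-nonterminal (Δ , m) (A∈ (proj₂ (wellFormed _ reach) irreducible))
      where
      A∈ : Sentence G (L ++ A ∷ X ∷ r) → A ∈ Vt
      A∈ σ∈ with ++⁻ʳ L σ∈
      ... | A∈ ∷ _ = A∈
      irreducible : ∀ w → ¬ ((L ++ A ∷ X ∷ r) ⇒ w)
      irreducible w (τ₁ , Γ , _ , τ₂ , (m″ , e″ , least″) , _)
        with least″ (A ∷ X ∷ []) Δ m L r refl | least″ [ y ] Δ′ m′ γ₁ γ₂ e | split τ₁ τ₂ m″ e″
      ... | _ , τ₁≤L | _       | inj₁ (τ , refl , _)          = <⇒≱ (∷ʳ-++-longer L A τ) τ₁≤L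
      ... | _        | Γ≤1 , _ | inj₂ (_ , _ , _ , refl , _) = <⇒≱ (s≤s (s≤s z≤n)) Γ≤1

    least : ∀ Γ′ Δ′ → (Γ′ , Δ′) Mem.∈ P → ∀ γ₁ γ₂ → L ++ A ∷ X ∷ r ≡ γ₁ ++ Γ′ ++ γ₂ →
            2 ≤ length Γ′ × length L ≤ length γ₁
    least Γ′ Δ′ m′ γ₁ γ₂ e with split γ₁ γ₂ m′ e | lhs-oneOrTwo m′
    ... | inj₁ (τ , refl , _)          | one y   = ⊥-elim (no-single y _ γ₂ e (Δ′ , m′))
    ... | inj₁ (τ , refl , _)          | two _ _ = s≤s (s≤s z≤n) , <⇒≤ (∷ʳ-++-longer L A τ)
    ... | inj₂ (a , b , eL , refl , _) | _       =
      s≤s (s≤s z≤n) , ≤-reflexive (cong length (proj₁ (∷ʳ-injective L γ₁ eL)))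

module Configurations (n : ℕ) where

  -- output and stack list the squares left of the scanned ones on the middle and bottom tapes,
  -- nearest first; word c is the sentential form spelled by the three tapes.
  record Cfg : Set where
    constructor cfg
    field
      output stack      : Str n
      below focus above : Maybe (Fin n)
      pending           : Str n
  open Cfg public

  Represents : MState n → Cfg → Set
  Represents s c = top s ≗ tape [] (above c) (pending c)
                 × mid s ≗ tape (output c) (focus c) []
                 × bot s ≗ tape (stack c) (below c) []

  left word : Cfg → Str n
  left c = reverse (fromMaybe (below c) ++ stack c ++ output c)
  word c = left c ++ fromMaybe (focus c) ++ fromMaybe (above c) ++ pending c

  module _ {s : MState n} {o st r : Str n} where

    represents-load : ∀ {b C} → Represents s (cfg o st b nothing (just C) r) →
      Represents ⟨ write nothing (top s) , write (just C) (mid s) , bot s ⟩ (cfg o st b (just C) nothing r)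
    represents-load (t , m , b) = write-tape nothing t , write-tape (just _) m , b

    represents-push : ∀ {B} → Represents s (cfg o st nothing (just B) nothing r) →
      Represents ⟨ moveL (top s) , write nothing (mid s) , write (just B) (bot s) ⟩
                 (cfg o st (just B) nothing (head r) (drop 1 r))
    represents-push (t , m , b) = moveL-blank t , write-tape nothing m , write-tape (just _) b

    represents-rewind : ∀ {b B C} → Represents s (cfg o st b (just B) (just C) r) →
      Represents ⟨ moveR (top s) , mid s , bot s ⟩ (cfg o st b (just B) nothing (C ∷ r))
    represents-rewind (t , m , b) = moveR-just t , m , b

    represents-hide : ∀ {A B} → Represents s (cfg o st (just A) (just B) nothing r) →
      Represents ⟨ top s , mid s , moveL (bot s) ⟩ (cfg o (A ∷ st) nothing (just B) nothing r)
    represents-hide (t , m , b) = t , m , moveL-just b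

    represents-reduce : ∀ {b B C} Δ → Represents s (cfg o st b (just B) nothing r) →
      Represents ⟨ write (rhsTop Δ) (top s) , write (just C) (mid s) , moveR (write nothing (bot s)) ⟩
                 (cfg o (drop 1 st) (head st) (just C) (rhsTop Δ) r)
    represents-reduce Δ (t , m , b) =
      write-tape (rhsTop Δ) t , write-tape (just _) m , moveR-blank (write-tape nothing b)

    represents-emit : ∀ {D} → Represents s (cfg o st nothing (just D) nothing r) →
      Represents ⟨ moveL (top s) , moveL (mid s) , bot s ⟩ (cfg (D ∷ o) st nothing nothing (head r) (drop 1 r))
    represents-emit (t , m , b) = moveL-blank t , moveL-just m , b

  left-below : ∀ c → left c ≡ reverse (stack c ++ output c) ++ fromMaybe (below c)
  left-below (cfg o st nothing  _ _ _) = sym (++-identityʳ (reverse (st ++ o)))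
  left-below (cfg o st (just A) _ _ _) = unfold-reverse A (st ++ o)

  word-at-focus : ∀ o st b X r → word (cfg o st b (just X) nothing r) ≡ reverse (st ++ o) ++ ctxLhs b X ++ r
  word-at-focus o st nothing  X r = refl
  word-at-focus o st (just A) X r = reverse-∷-++ A (st ++ o) (X ∷ r)

  word-reduce : ∀ o st C Δ r → (Δ ≡ [ C ] ⊎ ∃ λ D → Δ ≡ C ∷ D ∷ []) →
    word (cfg o (drop 1 st) (head st) (just C) (rhsTop Δ) r) ≡ reverse (st ++ o) ++ Δ ++ r
  word-reduce o st C _ r (inj₁ refl)       = cong (λ σ → reverse σ ++ C ∷ r) (head-drop-++ st o)
  word-reduce o st C _ r (inj₂ (D , refl)) = cong (λ σ → reverse σ ++ C ∷ D ∷ r) (head-drop-++ st o)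

  halted : Str n → Cfg
  halted σ = cfg (reverse σ) [] nothing nothing nothing []

  word-halted : ∀ σ → word (halted σ) ≡ σ
  word-halted σ = trans (++-identityʳ _) (reverse-involutive σ)

module Simulation {n : ℕ} (G : Grammar n) (SA : StandingAssumptions G) where

  open Grammar G
  open Sentential G
  open Leftmost G SA
  open Configurations n
  open Machine G

  -- An empty bottom square over a nonempty stack only arises from move 4, which has checked
  -- that the stack top and the focus form no left side.
  HiddenChecked : Cfg → Set
  HiddenChecked c = below c ≡ nothing → stack c ≡ [] ⊎ ∃ λ X → focus c ≡ just X × SeamFree (left c) X

  record Good (c : Cfg) : Set where
    constructor good
    field
      output-terminal   : All (_∈ Vt) (output c)
      stack-nonterminal : All (_∉ Vt) (fromMaybe (below c) ++ stack c)
      left-lhsFree      : LhsFree (left c)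
      hidden-checked    : HiddenChecked c
      reachable         : Reachable (word c)
  open Good

  seam-at-focus : ∀ {c X} → Good c → below c ≡ nothing → focus c ≡ just X → SeamFree (left c) X
  seam-at-focus {cfg o st b f a r} g b≡ f≡ with hidden-checked g b≡ | b≡
  ... | inj₁ refl              | refl = sentence-seamFree (all-reverse (output-terminal g))
  ... | inj₂ (_ , refl , seam) | _ with f≡
  ...   | refl = seam

  focus-leftmost : ∀ {o st b X r Δ} → Good (cfg o st b (just X) nothing r) → (ctxLhs b X , Δ) Mem.∈ P →
    LeftmostApplicable G (word (cfg o st b (just X) nothing r)) (reverse (st ++ o)) (ctxLhs b X) Δ r
  focus-leftmost {b = nothing} g m = leftmost-single (left-lhsFree g) (seam-at-focus g refl refl) m
  focus-leftmost {o} {st} {just A} {X} {r} {Δ} g m =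
    subst (λ w → LeftmostApplicable G w (reverse (st ++ o)) (A ∷ X ∷ []) Δ r) (sym at-focus)
      (leftmost-pair (subst LhsFree (unfold-reverse A (st ++ o)) (left-lhsFree g))
                     (subst Reachable at-focus (reachable g)) m)
    where
    at-focus : word (cfg o st (just A) (just X) nothing r) ≡ reverse (st ++ o) ++ A ∷ X ∷ r
    at-focus = word-at-focus o st (just A) X r

  -- Otherwise the emitted terminal would freeze a prefix containing the stacked nonterminals.
  emit-stack-empty : ∀ {o st D a r} → D ∈ Vt → Good (cfg o st nothing (just D) a r) → st ≡ []
  emit-stack-empty {st = []} _ _ = refl
  emit-stack-empty {o} {A ∷ st} {D} {a} {r} D∈ g with hidden-checked g refl
  ... | inj₂ (_ , refl , seam) =
    ⊥-elim (frozen-unreachable frozen nonsentence (fromMaybe a ++ r)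
             (subst Reachable (sym (∷ʳ-++ Q D _)) (reachable g)))
    where
    Q : Str n
    Q = reverse (A ∷ st ++ o)
    frozen : Frozen (Q ∷ʳ D)
    frozen = lhsFree-∷ʳ (left-lhsFree g) (λ lhs → lhs-starts-nonterminal lhs D∈) seam ,
             λ _ → terminal-seamFree D∈
    nonsentence : ¬ Sentence G (Q ∷ʳ D)
    nonsentence σ∈ with stack-nonterminal g
    ... | A∉ ∷ _ = A∉ (all-reverse-∷⁻ {xs = st ++ o} (++⁻ˡ Q σ∈))

  module _ {o st r : Str n} where

    good-load : ∀ {b C} → Good (cfg o st b nothing (just C) r) → Good (cfg o st b (just C) nothing r)
    good-load {b} {C} (good o∈ st∉ free hidden reach) = good o∈ st∉ free hidden′ reach
      where
      hidden′ : HiddenChecked (cfg o st b (just C) nothing r)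
      hidden′ b≡ with hidden b≡
      ... | inj₁ st≡ = inj₁ st≡
      ... | inj₂ (_ , () , _)

    good-push : ∀ {B} → ¬ IsLhs [ B ] → B ∉ Vt → Good (cfg o st nothing (just B) nothing r) →
      Good (cfg o st (just B) nothing (head r) (drop 1 r))
    good-push {B} ¬lhs B∉ g@(good o∈ st∉ free _ reach) =
      good o∈ (B∉ ∷ st∉)
           (subst LhsFree (sym (unfold-reverse B (st ++ o))) (lhsFree-∷ʳ free ¬lhs (seam-at-focus g refl refl)))
           (λ ())
           (subst Reachable (reverse-shift B (st ++ o) r) reach)

    good-rewind : ∀ {b B C} → Good (cfg o st b (just B) (just C) r) → Good (cfg o st b (just B) nothing (C ∷ r))
    good-rewind (good o∈ st∉ free hidden reach) = good o∈ st∉ free hidden reach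

    good-hide : ∀ {A X} → ¬ IsLhs (A ∷ X ∷ []) → Good (cfg o st (just A) (just X) nothing r) →
      Good (cfg o (A ∷ st) nothing (just X) nothing r)
    good-hide {A} {X} ¬lhs (good o∈ st∉ free _ reach) =
      good o∈ st∉ free (λ _ → inj₂ (X , refl , seam)) reach
      where
      seam : SeamFree (reverse (A ∷ st ++ o)) X
      seam = subst (λ σ → SeamFree σ X) (sym (unfold-reverse A (st ++ o))) (seamFree-∷ʳ ¬lhs)

    good-reduce : ∀ {b X C Δ} → (ctxLhs b X , Δ) Mem.∈ P → (Δ ≡ [ C ] ⊎ ∃ λ D → Δ ≡ C ∷ D ∷ []) →
      Good (cfg o st b (just X) nothing r) → Good (cfg o (drop 1 st) (head st) (just C) (rhsTop Δ) r)
    good-reduce {b} {X} {C} {Δ} m shape g@(good o∈ st∉ free _ reach) =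
      good o∈ st∉′ free′ hidden′ (reach ◅◅ step ◅ ε)
      where
      st∉′ : All (_∉ Vt) (fromMaybe (head st) ++ drop 1 st)
      st∉′ = subst (All (_∉ Vt)) (sym (head-drop st)) (++⁻ʳ (fromMaybe b) st∉)
      free′ : LhsFree (reverse (fromMaybe (head st) ++ drop 1 st ++ o))
      free′ = subst LhsFree (cong reverse (sym (head-drop-++ st o)))
                (lhsFree-++ˡ _ (fromMaybe b) (subst LhsFree (left-below (cfg o st b (just X) nothing r)) free))
      hidden′ : HiddenChecked (cfg o (drop 1 st) (head st) (just C) (rhsTop Δ) r)
      hidden′ e = inj₁ (cong (drop 1) (head≡nothing st e))
      step : word (cfg o st b (just X) nothing r) ⇒ word (cfg o (drop 1 st) (head st) (just C) (rhsTop Δ) r)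
      step = reverse (st ++ o) , ctxLhs b X , Δ , r , focus-leftmost g m , word-reduce o st C Δ r shape

  good-emit : ∀ {o D r} → D ∈ Vt → Good (cfg o [] nothing (just D) nothing r) →
    Good (cfg (D ∷ o) [] nothing nothing (head r) (drop 1 r))
  good-emit {o} {D} {r} D∈ (good o∈ _ _ _ reach) =
    good (D∈ ∷ o∈) [] (sentence-lhsFree (all-reverse (D∈ ∷ o∈))) (λ _ → inj₁ refl)
         (subst Reachable (reverse-shift D o r) reach)

  module _ (s : MState n) where

    App5⇔IsLhs : ∀ {B b} → top s 0ℤ ≡ nothing → mid s 0ℤ ≡ just B → bot s 0ℤ ≡ b →
      App5 s ⇔ IsLhs (ctxLhs b B)
    App5⇔IsLhs {B} {b} t0 m0 b0 = mk⇔ to from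
      where
      to : App5 s → IsLhs (ctxLhs b B)
      to (_ , B′ , m0′ , Δ , m) with trans (sym m0) m0′
      ... | refl = Δ , subst (λ b′ → (ctxLhs b′ B , Δ) Mem.∈ P) b0 m
      from : IsLhs (ctxLhs b B) → App5 s
      from (Δ , m) = t0 , B , m0 , Δ , subst (λ b′ → (ctxLhs b′ B , Δ) Mem.∈ P) (sym b0) m

    App6⇔terminal : ∀ {B} → top s 0ℤ ≡ nothing → bot s 0ℤ ≡ nothing → mid s 0ℤ ≡ just B →
      App6 s ⇔ B ∈ Vt
    App6⇔terminal {B} t0 b0 m0 = mk⇔ to (λ B∈ → t0 , b0 , B , m0 , B∈)
      where
      to : App6 s → B ∈ Vt
      to (_ , _ , B′ , m0′ , B′∈) with trans (sym m0) m0′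
      ... | refl = B′∈

    top≡just⇒¬App5 : ∀ {C} → top s 0ℤ ≡ just C → ¬ App5 s
    top≡just⇒¬App5 t0 (t0′ , _) = just≢nothing (trans (sym t0) t0′)

    top≡just⇒¬App6 : ∀ {C} → top s 0ℤ ≡ just C → ¬ App6 s
    top≡just⇒¬App6 t0 (t0′ , _) = just≢nothing (trans (sym t0) t0′)

    top≡just⇒¬App2 : ∀ {C} → top s 0ℤ ≡ just C → ¬ App2 s
    top≡just⇒¬App2 t0 (t0′ , _) = just≢nothing (trans (sym t0) t0′)

    top≡nothing⇒¬App3 : top s 0ℤ ≡ nothing → ¬ App3 s
    top≡nothing⇒¬App3 t0 ((_ , t0′) , _) = just≢nothing (trans (sym t0′) t0)

    mid≡nothing⇒¬App5 : mid s 0ℤ ≡ nothing → ¬ App5 s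
    mid≡nothing⇒¬App5 m0 (_ , _ , m0′ , _) = just≢nothing (trans (sym m0′) m0)

    mid≡nothing⇒¬App6 : mid s 0ℤ ≡ nothing → ¬ App6 s
    mid≡nothing⇒¬App6 m0 (_ , _ , _ , m0′ , _) = just≢nothing (trans (sym m0′) m0)

    mid≡just⇒¬App1 : ∀ {B} → mid s 0ℤ ≡ just B → ¬ App1 s
    mid≡just⇒¬App1 m0 (_ , m0′) = just≢nothing (trans (sym m0) m0′)

    bot≡just⇒¬App6 : ∀ {A} → bot s 0ℤ ≡ just A → ¬ App6 s
    bot≡just⇒¬App6 b0 (_ , b0′ , _) = just≢nothing (trans (sym b0) b0′)

    bot≡just⇒¬App2 : ∀ {A} → bot s 0ℤ ≡ just A → ¬ App2 s
    bot≡just⇒¬App2 b0 (_ , _ , b0′) = just≢nothing (trans (sym b0) b0′)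

  ¬App5-at-focus : ∀ {s o st b X r} → Represents s (cfg o st b (just X) nothing r) →
    ¬ IsLhs (ctxLhs b X) → ¬ App5 s
  ¬App5-at-focus {s} (t , m , bt) ¬lhs = ¬lhs ∘ Equivalence.to (App5⇔IsLhs s (t 0ℤ) (m 0ℤ) (bt 0ℤ))

  step-sound : ∀ {s s′ c} → Represents s c → Good c → Step s s′ → ∃ λ c′ → Represents s′ c′ × Good c′
  step-sound {c = cfg o st b f a r} rep@(t , m , _) g (move1 C _ _ t0 m0)
    with trans (sym (t 0ℤ)) t0 | trans (sym (m 0ℤ)) m0
  ... | refl | refl = _ , represents-load rep , good-load g
  step-sound {s} {c = cfg o st b f a r} rep@(t , m , bt) g (move2 B ¬5 ¬6 _ t0 m0 b0)
    with trans (sym (t 0ℤ)) t0 | trans (sym (m 0ℤ)) m0 | trans (sym (bt 0ℤ)) b0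
  ... | refl | refl | refl =
    _ , represents-push rep ,
    good-push (¬5 ∘ Equivalence.from (App5⇔IsLhs s t0 m0 b0))
              (¬6 ∘ Equivalence.from (App6⇔terminal s t0 b0 m0)) g
  step-sound {c = cfg o st b f a r} rep@(t , m , _) g (move3 _ _ _ _ ((C , t0) , (B , m0)))
    with trans (sym (t 0ℤ)) t0 | trans (sym (m 0ℤ)) m0
  ... | refl | refl = _ , represents-rewind rep , good-rewind g
  step-sound {s} {c = cfg o st b f a r} rep@(t , m , bt) g (move4 ¬5 _ _ _ _ (t0 , (B , m0) , (A , b0)))
    with trans (sym (t 0ℤ)) t0 | trans (sym (m 0ℤ)) m0 | trans (sym (bt 0ℤ)) b0
  ... | refl | refl | refl =
    _ , represents-hide rep , good-hide (¬5 ∘ Equivalence.from (App5⇔IsLhs s t0 m0 b0)) g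
  step-sound {c = cfg o st b f a r} rep@(t , m , bt) g (move5 B C Δ t0 m0 mem shape)
    with trans (sym (t 0ℤ)) t0 | trans (sym (m 0ℤ)) m0
  ... | refl | refl =
    _ , represents-reduce Δ rep , good-reduce (subst (λ b′ → (ctxLhs b′ B , Δ) Mem.∈ P) (bt 0ℤ) mem) shape g
  step-sound {c = cfg o st b f a r} rep@(t , m , bt) g (move6 _ (t0 , b0 , D , m0 , D∈))
    with trans (sym (t 0ℤ)) t0 | trans (sym (m 0ℤ)) m0 | trans (sym (bt 0ℤ)) b0
  ... | refl | refl | refl with emit-stack-empty D∈ g
  ...   | refl = _ , represents-emit rep , good-emit D∈ g

  final⇔halted : ∀ {s c σ} → Represents s c → Final G σ s ⇔ c ≡ halted σ
  final⇔halted {s} {cfg o st b f a r} {σ} (t , m , bt) = mk⇔ to from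
    where
    to : Final G σ s → cfg o st b f a r ≡ halted σ
    to final
      with tape-injective (λ i → trans (sym (t i)) (trans (proj₁ (final i)) (emptyTape≗tape i)))
         | tape-injective (λ i → trans (sym (m i)) (trans (proj₁ (proj₂ (final i))) (outputTape≗tape σ i)))
         | tape-injective (λ i → trans (sym (bt i)) (trans (proj₂ (proj₂ (final i))) (emptyTape≗tape i)))
    ... | _ , refl , refl | refl , refl , _ | refl , refl , _ = refl
    from : cfg o st b f a r ≡ halted σ → Final G σ s
    from refl i = trans (t i) (sym (emptyTape≗tape i)) ,
                  trans (m i) (sym (outputTape≗tape σ i)) ,
                  trans (bt i) (sym (emptyTape≗tape i))

  run-sound : ∀ {s s′ c σ} → Represents s c → Good c → Star Step s s′ → Final G σ s′ → Reachable σ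
  run-sound {σ = σ} rep g ε final with Equivalence.to (final⇔halted rep) final
  ... | refl = subst Reachable (word-halted σ) (reachable g)
  run-sound rep g (step ◅ steps) final with step-sound rep g step
  ... | _ , rep′ , g′ = run-sound rep′ g′ steps final

  start : Cfg
  start = cfg [] [] nothing nothing (just S) []

  represents-start : Represents initial start
  represents-start = write-tape (just S) emptyTape≗tape , emptyTape≗tape , emptyTape≗tape

  good-start : Good start
  good-start = good [] [] (sentence-lhsFree []) (λ _ → inj₁ refl) ε

  module Completeness (σ : Str n) (σ∈ : Sentence G σ) where

    ReachesFinal : MState n → Set
    ReachesFinal s = ∃ λ s′ → Star Step s s′ × Final G σ s′

    _◅′_ : ∀ {s s₁} → Step s s₁ → ReachesFinal s₁ → ReachesFinal s
    step ◅′ (s′ , steps , final) = s′ , step ◅ steps , final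
    infixr 5 _◅′_

    unfocused : Str n → Str n → Str n → Cfg
    unfocused o st r = cfg o (drop 1 st) (head st) nothing (head r) (drop 1 r)

    -- Every cycle through these functions either consumes a derivation step (run-reduce) or
    -- a symbol of the unread input (run-unfocused); the derivation's start word is kept
    -- abstract (linked to the configuration by eq) so that it is passed on unchanged.
    mutual
      run-unfocused : ∀ {s w} o st r → Star _⇒_ w σ → word (unfocused o st r) ≡ w →
        Represents s (unfocused o st r) → Good (unfocused o st r) → ReachesFinal s
      run-unfocused {s} o [] [] ε eq rep g =
        s , ε , Equivalence.from (final⇔halted rep) (cong (λ o′ → cfg o′ [] nothing nothing nothing []) o≡)
        where
        o≡ : o ≡ reverse σ
        o≡ = trans (sym (reverse-involutive o)) (cong reverse (trans (sym (++-identityʳ _)) eq))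
      run-unfocused o (A ∷ st) [] ε eq rep g with stack-nonterminal g
      ... | A∉ ∷ _ =
        ⊥-elim (A∉ (all-reverse-∷⁻ {xs = st ++ o} (++⁻ˡ _ (subst (Sentence G) (sym eq) σ∈))))
      run-unfocused o st [] ((σ₁ , Γ , Δ , σ₂ , (m , e , _) , _) ◅ _) refl rep g =
        ⊥-elim (left-lhsFree g σ₁ Γ σ₂ (trans (sym (++-identityʳ _)) e) (Δ , m))
      run-unfocused {s} o st (C ∷ r) d eq rep@(t , m , _) g =
        move1 C (mid≡nothing⇒¬App5 s (m 0ℤ)) (mid≡nothing⇒¬App6 s (m 0ℤ)) (t 0ℤ) (m 0ℤ)
        ◅′ run-ready o (drop 1 st) (head st) C r d eq (represents-load rep) (good-load g)

      run-focused : ∀ {s w} o st b X a r → Star _⇒_ w σ → word (cfg o st b (just X) a r) ≡ w →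
        Represents s (cfg o st b (just X) a r) → Good (cfg o st b (just X) a r) → ReachesFinal s
      run-focused o st b X nothing r d eq rep g = run-ready o st b X r d eq rep g
      run-focused {s} o st b X (just D) r d eq rep@(t , m , _) g =
        move3 (top≡just⇒¬App5 s (t 0ℤ)) (top≡just⇒¬App6 s (t 0ℤ)) (mid≡just⇒¬App1 s (m 0ℤ))
              (top≡just⇒¬App2 s (t 0ℤ)) ((D , t 0ℤ) , (X , m 0ℤ))
        ◅′ run-ready o st b X (D ∷ r) d eq (represents-rewind rep) (good-rewind g)

      run-ready : ∀ {s w} o st b X r → Star _⇒_ w σ → word (cfg o st b (just X) nothing r) ≡ w →
        Represents s (cfg o st b (just X) nothing r) → Good (cfg o st b (just X) nothing r) → ReachesFinal s
      run-ready o st nothing X r d eq rep g = run-ready-bottom-empty o st X r d eq rep g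
      run-ready {s} o st (just A) X r d eq rep@(t , m , bt) g with isLhs? (A ∷ X ∷ [])
      ... | yes lhs = run-reduce o st (just A) X r d eq rep g lhs
      ... | no ¬lhs =
        move4 (¬App5-at-focus rep ¬lhs)
              (bot≡just⇒¬App6 s (bt 0ℤ)) (mid≡just⇒¬App1 s (m 0ℤ)) (bot≡just⇒¬App2 s (bt 0ℤ))
              (top≡nothing⇒¬App3 s (t 0ℤ)) (t 0ℤ , (X , m 0ℤ) , (A , bt 0ℤ))
        ◅′ run-ready-bottom-empty o (A ∷ st) X r d eq (represents-hide rep) (good-hide ¬lhs g)

      run-ready-bottom-empty : ∀ {s w} o st X r → Star _⇒_ w σ →
        word (cfg o st nothing (just X) nothing r) ≡ w → Represents s (cfg o st nothing (just X) nothing r) →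
        Good (cfg o st nothing (just X) nothing r) → ReachesFinal s
      run-ready-bottom-empty {s} o st X r d eq rep@(t , m , bt) g with isLhs? [ X ] | X ∈? Vt
      ... | yes lhs | _ = run-reduce o st nothing X r d eq rep g lhs
      ... | no ¬lhs | yes X∈ with emit-stack-empty X∈ g
      ...   | refl =
        move6 (¬App5-at-focus rep ¬lhs) (t 0ℤ , bt 0ℤ , X , m 0ℤ , X∈)
        ◅′ run-unfocused (X ∷ o) [] r d (trans (sym (reverse-shift X o r)) eq)
                         (represents-emit rep) (good-emit X∈ g)
      run-ready-bottom-empty {s} o st X r d eq rep@(t , m , bt) g | no ¬lhs | no X∉ =
        move2 X (¬App5-at-focus rep ¬lhs)
                (X∉ ∘ Equivalence.to (App6⇔terminal s (t 0ℤ) (bt 0ℤ) (m 0ℤ)))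
                (mid≡just⇒¬App1 s (m 0ℤ)) (t 0ℤ) (m 0ℤ) (bt 0ℤ)
        ◅′ run-unfocused o (X ∷ st) r d (trans (sym (reverse-shift X (st ++ o) r)) eq)
                         (represents-push rep) (good-push ¬lhs X∉ g)

      run-reduce : ∀ {s w} o st b X r → Star _⇒_ w σ → word (cfg o st b (just X) nothing r) ≡ w →
        Represents s (cfg o st b (just X) nothing r) → Good (cfg o st b (just X) nothing r) →
        IsLhs (ctxLhs b X) → ReachesFinal s
      run-reduce o st b X r ε eq rep g (Δ , m) =
        ⊥-elim (sentence-lhsFree σ∈ (reverse (st ++ o)) (ctxLhs b X) r
                  (trans (sym eq) (proj₁ (proj₂ (focus-leftmost g m)))) (Δ , m))
      run-reduce {s} o st b X r ((τ₁ , Γ , Δ , τ₂ , lm , refl) ◅ d) refl rep@(t , m , bt) g (Δ* , m*)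
        with leftmost-unique {σ₁ = reverse (st ++ o)} {Γ = ctxLhs b X} {σ₂ = r} {τ₁ = τ₁} {Γ} {Δ} {τ₂}
               (focus-leftmost g m*) lm
      ... | refl , refl , refl with rhs-shape (proj₁ lm)
      ...   | C , shape =
        move5 X C Δ (t 0ℤ) (m 0ℤ) (subst (λ b′ → (ctxLhs b′ X , Δ) Mem.∈ P) (sym (bt 0ℤ)) (proj₁ lm)) shape
        ◅′ run-focused o (drop 1 st) (head st) C (rhsTop Δ) r d (word-reduce o st C Δ r shape)
                       (represents-reduce Δ rep) (good-reduce (proj₁ lm) shape g)

    complete : Reachable σ → Producible G σ
    complete derivation = run-unfocused [] [] [ S ] derivation refl represents-start good-start

mainTheorem1 : ∀ {n : ℕ} (G : Grammar n) → StandingAssumptions G →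
    ∀ σ → Sentence G σ → (Producible G σ ⇔ InLeftmostLanguage G σ)
mainTheorem1 G SA σ σ∈ = mk⇔
  (λ (_ , run , final) → σ∈ , run-sound represents-start good-start run final)
  (λ (_ , derivation) → complete derivation)
  where
  open Simulation G SA
  open Completeness σ σ∈
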